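{- Let $q$ be a power of an odd prime with $q\equiv 1\pmod 3$, and let $\zeta\in\mathbb{F}_q^{\ast}$ be an element of order $3$. Let $m,d$ be positive integers with $q-1=md$, $d\equiv 0\pmod 3$ and $\varphi(m)\ge 3$. Let $u,v,w\in\mathbb{F}_q^{\ast}$ be three elements, not all equal, each of multiplicative order $m$. Put $a=(u+v\zeta+w\zeta^2)/3$, $b=(u+v\zeta^2+w\zeta)/3$, $c=(u+v+w)/3$ and $f(x)=ax^{(2q+1)/3}+bx^{(q+2)/3}+cx$. Then: (i) $f$ is a permutation polynomial of $\mathbb{F}_q$; (ii) the permutation induced by $f$ has cycle type $1+m^d$; (iii) the inverse permutation is induced by the trinomial $a'x^{(2q+1)/3}+b'x^{(q+2)/3}+c'x$, where $a'=(u^{ -1}+v^{ -1}\zeta+w^{ -1}\zeta^2)/3$, $b'=(u^{ -1}+v^{ -1}\zeta^2+w^{ -1}\zeta)/3$ and $c'=(u^{ -1}+v^{ -1}+w^{ -1})/3$.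
   Context: $\varphi$ denotes Euler's totient function. The order of a nonzero element means its order in $\mathbb{F}_q^{\ast}$. Cycle type $1+m^d$ means the permutation has exactly one fixed point and its remaining elements form $d$ disjoint cycles each of length $m$. -}

module Defs where

open import Level using (0ℓ)
open import Data.Nat using (ℕ; zero; suc; _<_)
open import Data.Nat.GCD using (gcd)
open import Data.Nat.Properties using (_≟_)
open import Data.Fin using (Fin)
open import Data.List using (List; length; filter; upTo; map)
open import Data.Product using (∃; _×_; Σ)
open import Relation.Binary.PropositionalEquality using (_≡_; _≢_)
open import Algebra.Core using (Op₁; Op₂)
open import Algebra.Structures using (IsCommutativeRing)
open import Function.Bundles using (_↔_)

φ : ℕ → ℕ
φ m = length (filter (λ k → gcd k m ≟ 1) (map suc (upTo m)))

record FiniteField (q : ℕ) : Set₁ where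
  infixl 7 _*_
  infixl 6 _+_
  field
    Carrier : Set
    _+_ : Op₂ Carrier
    _*_ : Op₂ Carrier
    -_  : Op₁ Carrier
    0#  : Carrier
    1#  : Carrier
    isCommutativeRing : IsCommutativeRing _≡_ _+_ _*_ -_ 0# 1#
    0≢1 : 0# ≢ 1#
    inverse : ∀ x → x ≢ 0# → ∃ λ y → x * y ≡ 1#
    card : Carrier ↔ Fin q

  _^_ : Carrier → ℕ → Carrier
  x ^ zero = 1#
  x ^ suc n = x * (x ^ n)

  HasOrder : Carrier → ℕ → Set
  HasOrder x m = (0 < m) × (x ^ m ≡ 1#) × (∀ k → 0 < k → k < m → x ^ k ≢ 1#)

  iter : (Carrier → Carrier) → ℕ → Carrier → Carrier
  iter g zero x = x
  iter g (suc n) x = g (iter g n x)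

  CycleType1+m : (Carrier → Carrier) → ℕ → Set
  CycleType1+m g m =
    (∃ λ x₀ → g x₀ ≡ x₀ × (∀ y → g y ≡ y → y ≡ x₀) ×
      (∀ y → y ≢ x₀ → iter g m y ≡ y × (∀ k → 0 < k → k < m → iter g k y ≢ y)))

-- Write q = 3N + 1. Then f x = P (x ^ N) * x with P ρ = a ρ² + b ρ + c, and for x ≠ 0 the element
-- x ^ N is a cube root of unity by Fermat's little theorem. The coefficients a, b, c are the discrete
-- Fourier transform of (u, v, w), so P 1 = u, P ζ = v and P ζ² = w: on each coset of the cubes, f is
-- multiplication by one of u, v, w. Their order m divides N, so these multiplications preserve x ^ N,
-- whence f ^ k x = λ ^ k x with λ of order m, giving the cycle type; and the trinomial built from
-- u⁻¹, v⁻¹, w⁻¹ multiplies by λ⁻¹ on the same coset, so it inverts f.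

module Submission where

open import Defs
open import Data.Nat using (ℕ; suc; _≤_; _∸_; _/_; _%_) renaming (_+_ to _+ℕ_; _*_ to _*ℕ_; _^_ to _^ℕ_)
open import Data.Nat.Primality using (Prime)
open import Data.Product using (∃; ∃₂; _×_; _,_)
open import Data.Sum using (_⊎_)
open import Relation.Nullary using (¬_)
open import Relation.Binary.PropositionalEquality using (_≡_; _≢_)
open import Function.Bundles using (Inverse; _↔_)

open import Level using (0ℓ)
open import Algebra.Bundles using (CommutativeRing)
open import Algebra.Structures using (IsCommutativeRing)
import Algebra.Properties.CommutativeMonoid.Sum as MonoidSum
import Algebra.Properties.CommutativeSemiring.Exp as SemiringExp
import Algebra.Properties.Group as GroupProperties
import Algebra.Solver.Ring.NaturalCoefficients.Default as SemiringSolver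
open import Data.Empty using (⊥-elim)
open import Data.Fin as Fin using (Fin; punchIn)
open import Data.Fin.Properties using (punchInᵢ≢i)
open import Data.Fin.Permutation as Permutation using (Permutation; _⟨$⟩ʳ_)
open import Data.List using (upTo; map)
open import Data.List.Properties using (length-filter; length-map; length-upTo)
open import Data.Nat using (zero; _<_; z≤n; s≤s; NonZero)
open import Data.Nat.Divisibility using (_∣_; divides; m%n≡0⇒n∣m)
open import Data.Nat.DivMod using (m≡m%n+[m/n]*n; m*n/n≡m)
import Data.Nat.Properties as ℕ
open import Data.Nat.Tactic.RingSolver using (solve-∀)
open import Data.Product using (proj₁; proj₂)
open import Data.Sum using (inj₁; inj₂)
open import Data.Vec.Functional using (replicate)
open import Function.Base using (_∘_)
open import Function.Bundles using (mk↔ₛ′)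
open import Function.Construct.Composition using (_↔-∘_)
open import Function.Construct.Symmetry using (↔-sym)
open import Function.Properties.Inverse using (↔⇒↣)
open import Relation.Binary.Definitions using (DecidableEquality)
open import Relation.Binary.PropositionalEquality
  using (refl; sym; trans; cong; cong₂; subst; subst₂; module ≡-Reasoning)
open import Relation.Nullary using (Dec; yes; no)
open import Relation.Nullary.Decidable using (via-injection)

φ≤id : ∀ m → φ m ≤ m
φ≤id m = ℕ.≤-trans (length-filter _ (map suc (upTo m))) (ℕ.≤-reflexive (trans (length-map suc (upTo m)) (length-upTo m)))

module FieldProperties {q : ℕ} (F : FiniteField q) where
  open FiniteField F
  open IsCommutativeRing isCommutativeRing public
    using (+-identityˡ; +-identityʳ; *-assoc; *-comm; *-identityˡ; *-identityʳ; zeroˡ; zeroʳ)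

  commutativeRing : CommutativeRing 0ℓ 0ℓ
  commutativeRing = record { isCommutativeRing = isCommutativeRing }

  open CommutativeRing commutativeRing public using (commutativeSemiring; *-commutativeMonoid; +-group)
  open GroupProperties +-group public using () renaming (∙-cancelʳ to +-cancelʳ)

  _≟_ : DecidableEquality Carrier
  _≟_ = via-injection (↔⇒↣ card) Fin._≟_

  *-inverse-cancelˡ : ∀ {x x′} → x′ * x ≡ 1# → ∀ y → x′ * (x * y) ≡ y
  *-inverse-cancelˡ {x} {x′} x′x≡1 y = begin
    x′ * (x * y)  ≡⟨ *-assoc x′ x y ⟨
    x′ * x * y    ≡⟨ cong (_* y) x′x≡1 ⟩
    1# * y        ≡⟨ *-identityˡ y ⟩
    y             ∎
    where open ≡-Reasoning

  *-cancelʳ : ∀ {x y z} → x ≢ 0# → y * x ≡ z * x → y ≡ z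
  *-cancelʳ {x} {y} {z} x≢0 yx≡zx with inverse x x≢0
  ... | x⁻¹ , xx⁻¹≡1 = begin
    y                ≡⟨ cancel y ⟨
    x⁻¹ * (x * y)    ≡⟨ cong (x⁻¹ *_) (trans (*-comm x y) (trans yx≡zx (*-comm z x))) ⟩
    x⁻¹ * (x * z)    ≡⟨ cancel z ⟩
    z                ∎
    where
      open ≡-Reasoning
      cancel = *-inverse-cancelˡ (trans (*-comm x⁻¹ x) xx⁻¹≡1)

  *-≢0 : ∀ {x y} → x ≢ 0# → y ≢ 0# → x * y ≢ 0#
  *-≢0 x≢0 y≢0 xy≡0 = x≢0 (*-cancelʳ y≢0 (trans xy≡0 (sym (zeroˡ _))))

  module Exp = SemiringExp commutativeSemiring

  ^≡Exp^ : ∀ x n → x ^ n ≡ x Exp.^ n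
  ^≡Exp^ x zero    = refl
  ^≡Exp^ x (suc n) = cong (x *_) (^≡Exp^ x n)

  ^-homo-* : ∀ x m n → x ^ (m +ℕ n) ≡ x ^ m * x ^ n
  ^-homo-* x m n rewrite ^≡Exp^ x (m +ℕ n) | ^≡Exp^ x m | ^≡Exp^ x n = Exp.^-homo-* x m n

  ^-assocʳ : ∀ x m n → (x ^ m) ^ n ≡ x ^ (m *ℕ n)
  ^-assocʳ x m n rewrite ^≡Exp^ (x ^ m) n | ^≡Exp^ x m | ^≡Exp^ x (m *ℕ n) = Exp.^-assocʳ x m n

  ^-distrib-* : ∀ x y n → (x * y) ^ n ≡ x ^ n * y ^ n
  ^-distrib-* x y n rewrite ^≡Exp^ (x * y) n | ^≡Exp^ x n | ^≡Exp^ y n = Exp.^-distrib-* x y n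

  ^-zeroˡ : ∀ n → 1# ^ n ≡ 1#
  ^-zeroˡ zero    = refl
  ^-zeroˡ (suc n) = trans (*-identityˡ _) (^-zeroˡ n)

  ^-order : ∀ {x m n} → HasOrder x m → m ∣ n → x ^ n ≡ 1#
  ^-order {x} {m} (_ , x^m≡1 , _) (divides k refl) = begin
    x ^ (k *ℕ m)   ≡⟨ cong (x ^_) (ℕ.*-comm k m) ⟩
    x ^ (m *ℕ k)   ≡⟨ ^-assocʳ x m k ⟨
    (x ^ m) ^ k    ≡⟨ cong (_^ k) x^m≡1 ⟩
    1# ^ k         ≡⟨ ^-zeroˡ k ⟩
    1#             ∎
    where open ≡-Reasoning

  hasOrder⇒≢1 : ∀ {x m} → HasOrder x m → 1 < m → x ≢ 1#
  hasOrder⇒≢1 {x} (_ , _ , x-primitive) 1<m x≡1 = x-primitive 1 (s≤s z≤n) 1<m (trans (*-identityʳ x) x≡1)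

  ^-inverse : ∀ {x y n} → x * y ≡ 1# → x ^ n ≡ 1# → y ^ n ≡ 1#
  ^-inverse {x} {y} {n} xy≡1 xⁿ≡1 = begin
    y ^ n            ≡⟨ *-identityˡ _ ⟨
    1# * y ^ n       ≡⟨ cong (_* y ^ n) xⁿ≡1 ⟨
    x ^ n * y ^ n    ≡⟨ ^-distrib-* x y n ⟨
    (x * y) ^ n      ≡⟨ cong (_^ n) xy≡1 ⟩
    1# ^ n           ≡⟨ ^-zeroˡ n ⟩
    1#               ∎
    where open ≡-Reasoning

module FermatsLittleTheorem {q : ℕ} (F : FiniteField q) where
  open FiniteField F
  open FieldProperties F
  open MonoidSum *-commutativeMonoid
    using (∑-distrib-+; sum-replicate; sum-permute; sum-cong-≗) renaming (sum to product)

  product-scale : ∀ {k} x (f : Fin k → Carrier) → product (λ i → x * f i) ≡ x ^ k * product f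
  product-scale {k} x f =
    trans (∑-distrib-+ (replicate k x) f) (cong (_* product f) (trans (sum-replicate k) (sym (^≡Exp^ x k))))

  product≢0 : ∀ {k} (f : Fin k → Carrier) → (∀ i → f i ≢ 0#) → product f ≢ 0#
  product≢0 {zero}  f _   = 0≢1 ∘ sym
  product≢0 {suc k} f f≢0 = *-≢0 (f≢0 Fin.zero) (product≢0 (f ∘ Fin.suc) (f≢0 ∘ Fin.suc))

  -- Multiplication by x permutes the nonzero elements, so their product P satisfies x ^ n * P ≡ P.
  module _ {n} (enumeration : Carrier ↔ Fin (suc n)) {x x⁻¹ : Carrier} (xx⁻¹≡1 : x * x⁻¹ ≡ 1#) where
    open Inverse enumeration

    nonzero : Fin n → Carrier
    nonzero i = from (punchIn (to 0#) i)

    nonzero≢0 : ∀ i → nonzero i ≢ 0#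
    nonzero≢0 i eq = punchInᵢ≢i (to 0#) i (trans (sym (strictlyInverseˡ _)) (cong to eq))

    multiplication : Carrier ↔ Carrier
    multiplication = mk↔ₛ′ (x *_) (x⁻¹ *_)
      (*-inverse-cancelˡ xx⁻¹≡1) (*-inverse-cancelˡ (trans (*-comm x⁻¹ x) xx⁻¹≡1))

    scaling : Permutation (suc n) (suc n)
    scaling = enumeration ↔-∘ (multiplication ↔-∘ ↔-sym enumeration)

    scaling-fixes-0 : scaling ⟨$⟩ʳ to 0# ≡ to 0#
    scaling-fixes-0 = cong to (trans (cong (x *_) (strictlyInverseʳ 0#)) (zeroʳ x))

    nonzeroScaling : Permutation n n
    nonzeroScaling = Permutation.remove (to 0#) scaling

    nonzero-scaling : ∀ i → nonzero (nonzeroScaling ⟨$⟩ʳ i) ≡ x * nonzero i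
    nonzero-scaling i = begin
      from (punchIn (to 0#) (nonzeroScaling ⟨$⟩ʳ i))
        ≡⟨ cong (λ o → from (punchIn o (nonzeroScaling ⟨$⟩ʳ i))) scaling-fixes-0 ⟨
      from (punchIn (scaling ⟨$⟩ʳ to 0#) (nonzeroScaling ⟨$⟩ʳ i))
        ≡⟨ cong from (Permutation.punchIn-permute scaling _ i) ⟨
      from (to (x * nonzero i))
        ≡⟨ strictlyInverseʳ _ ⟩
      x * nonzero i ∎
      where open ≡-Reasoning

    fermat′ : x ^ n ≡ 1#
    fermat′ = *-cancelʳ (product≢0 nonzero nonzero≢0) (begin
      x ^ n * product nonzero                           ≡⟨ product-scale x nonzero ⟨
      product (λ i → x * nonzero i)                     ≡⟨ sum-cong-≗ nonzero-scaling ⟨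
      product (nonzero ∘ (nonzeroScaling ⟨$⟩ʳ_))        ≡⟨ sum-permute nonzero nonzeroScaling ⟨
      product nonzero                                   ≡⟨ *-identityˡ _ ⟨
      1# * product nonzero                              ∎)
      where open ≡-Reasoning

  fermat : ∀ {x} → x ≢ 0# → x ^ (q ∸ 1) ≡ 1#
  fermat {x} x≢0 with inverse x x≢0
  ... | x⁻¹ , xx⁻¹≡1 = fermat′ (subst (λ k → Carrier ↔ Fin k) (inhabited⇒≡1+ (Inverse.to card 0#)) card) xx⁻¹≡1
    where
      inhabited⇒≡1+ : ∀ {k} → Fin k → k ≡ suc (k ∸ 1)
      inhabited⇒≡1+ {suc k} _ = refl

module CubeRootsOfUnity {q : ℕ} (F : FiniteField q) where
  open FiniteField F
  open FieldProperties F
  open SemiringSolver commutativeSemiring using (solve; _:=_; _:+_; _:*_; con)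

  cubeRoot-sum≡0 : ∀ {y} → y ^ 3 ≡ 1# → y ≢ 1# → 1# + y + y * y ≡ 0#
  cubeRoot-sum≡0 {y} y³≡1 y≢1 with (1# + y + y * y) ≟ 0#
  ... | yes sum≡0 = sum≡0
  ... | no  sum≢0 = ⊥-elim (y≢1 (*-cancelʳ sum≢0 (begin
    y * (1# + y + y * y)     ≡⟨ solve 1 (λ y → y :* (con 1 :+ y :+ y :* y) := y :* (y :* (y :* con 1)) :+ y :+ y :* y) refl y ⟩
    y ^ 3 + y + y * y        ≡⟨ cong (λ r → r + y + y * y) y³≡1 ⟩
    1# + y + y * y           ≡⟨ *-identityˡ _ ⟨
    1# * (1# + y + y * y)    ∎)))
    where open ≡-Reasoning

  module _ {ζ} (ζ³≡1 : ζ ^ 3 ≡ 1#) (ζ≢1 : ζ ≢ 1#) where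

    cubeRoot-cases : ∀ {y} → y ^ 3 ≡ 1# → y ≡ 1# ⊎ y ≡ ζ ⊎ y ≡ ζ * ζ
    cubeRoot-cases {y} y³≡1 with y ≟ 1# | y ≟ ζ
    ... | yes y≡1 | _       = inj₁ y≡1
    ... | no _    | yes y≡ζ = inj₂ (inj₁ y≡ζ)
    ... | no y≢1  | no y≢ζ  = inj₂ (inj₂ (begin
      y                         ≡⟨ +-identityʳ y ⟨
      y + 0#                    ≡⟨ cong (y +_) (cubeRoot-sum≡0 ζ³≡1 ζ≢1) ⟨
      y + (1# + ζ + ζ * ζ)      ≡⟨ solve 2 (λ y ζ → y :+ (con 1 :+ ζ :+ ζ :* ζ) := (y :+ ζ :+ con 1) :+ ζ :* ζ) refl y ζ ⟩
      (y + ζ + 1#) + ζ * ζ      ≡⟨ cong (_+ ζ * ζ) y+ζ+1≡0 ⟩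
      0# + ζ * ζ                ≡⟨ +-identityˡ _ ⟩
      ζ * ζ                     ∎))
      where
        open ≡-Reasoning
        -- (y − ζ) (y + ζ + 1) = (1 + y + y²) − (1 + ζ + ζ²) = 0, and y ≢ ζ.
        y+ζ+1≡0 : y + ζ + 1# ≡ 0#
        y+ζ+1≡0 with (y + ζ + 1#) ≟ 0#
        ... | yes k≡0 = k≡0
        ... | no  k≢0 = ⊥-elim (y≢ζ (*-cancelʳ k≢0 (begin
          y * (y + ζ + 1#)                             ≡⟨ +-identityʳ _ ⟨
          y * (y + ζ + 1#) + 0#                        ≡⟨ cong (y * (y + ζ + 1#) +_) (cubeRoot-sum≡0 ζ³≡1 ζ≢1) ⟨
          y * (y + ζ + 1#) + (1# + ζ + ζ * ζ)          ≡⟨ solve 2 (λ y ζ → y :* (y :+ ζ :+ con 1) :+ (con 1 :+ ζ :+ ζ :* ζ)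
                                                                 := ζ :* (y :+ ζ :+ con 1) :+ (con 1 :+ y :+ y :* y)) refl y ζ ⟩
          ζ * (y + ζ + 1#) + (1# + y + y * y)          ≡⟨ cong (ζ * (y + ζ + 1#) +_) (cubeRoot-sum≡0 y³≡1 y≢1) ⟩
          ζ * (y + ζ + 1#) + 0#                        ≡⟨ +-identityʳ _ ⟩
          ζ * (y + ζ + 1#)                             ∎)))

module ScalingMaps {q : ℕ} (F : FiniteField q) where
  open FiniteField F
  open FieldProperties F

  module _ {f s : Carrier → Carrier} (f≡s* : ∀ x → f x ≡ s x * x) where

    scaling-preserves-^ : ∀ {n} → (∀ {x} → x ≢ 0# → s x ^ n ≡ 1#) → ∀ x → f x ^ n ≡ x ^ n
    scaling-preserves-^ {n} sⁿ≡1 x with x ≟ 0#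
    ... | yes refl = cong (_^ n) (trans (f≡s* 0#) (zeroʳ _))
    ... | no  x≢0  = begin
      f x ^ n              ≡⟨ cong (_^ n) (f≡s* x) ⟩
      (s x * x) ^ n        ≡⟨ ^-distrib-* (s x) x n ⟩
      s x ^ n * x ^ n      ≡⟨ cong (_* x ^ n) (sⁿ≡1 x≢0) ⟩
      1# * x ^ n           ≡⟨ *-identityˡ _ ⟩
      x ^ n                ∎
      where open ≡-Reasoning

    leftInverse : ∀ {g s′ : Carrier → Carrier} → (∀ x → g x ≡ s′ x * x) → (∀ x → s′ (f x) ≡ s′ x) →
                  (∀ {x} → x ≢ 0# → s′ x * s x ≡ 1#) → ∀ x → g (f x) ≡ x
    leftInverse {g} {s′} g≡s′* s′∘f≡s′ s′s≡1 x = trans g∘f≡s′s* (cancel-multiplier (x ≟ 0#))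
      where
        open ≡-Reasoning
        g∘f≡s′s* : g (f x) ≡ s′ x * s x * x
        g∘f≡s′s* = begin
          g (f x)              ≡⟨ g≡s′* (f x) ⟩
          s′ (f x) * f x       ≡⟨ cong₂ _*_ (s′∘f≡s′ x) (f≡s* x) ⟩
          s′ x * (s x * x)     ≡⟨ *-assoc (s′ x) (s x) x ⟨
          s′ x * s x * x       ∎
        cancel-multiplier : Dec (x ≡ 0#) → s′ x * s x * x ≡ x
        cancel-multiplier (yes x≡0) = trans (cong (s′ x * s x *_) x≡0) (trans (zeroʳ _) (sym x≡0))
        cancel-multiplier (no  x≢0) = trans (cong (_* x) (s′s≡1 x≢0)) (*-identityˡ x)

    module _ (s∘f≡s : ∀ x → s (f x) ≡ s x) where

      iter≡^* : ∀ k x → iter f k x ≡ s x ^ k * x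
      iter≡^* zero    x = sym (*-identityˡ x)
      iter≡^* (suc k) x = begin
        f (iter f k x)                       ≡⟨ f≡s* (iter f k x) ⟩
        s (iter f k x) * iter f k x          ≡⟨ cong₂ _*_ (s∘iter≡s k) (iter≡^* k x) ⟩
        s x * (s x ^ k * x)                  ≡⟨ *-assoc (s x) (s x ^ k) x ⟨
        s x ^ suc k * x                      ∎
        where
          open ≡-Reasoning
          s∘iter≡s : ∀ k → s (iter f k x) ≡ s x
          s∘iter≡s zero    = refl
          s∘iter≡s (suc k) = trans (s∘f≡s (iter f k x)) (s∘iter≡s k)

      orbit : ∀ {m x} → x ≢ 0# → HasOrder (s x) m →
              iter f m x ≡ x × (∀ k → 0 < k → k < m → iter f k x ≢ x)
      orbit {m} {x} x≢0 (_ , sᵐ≡1 , s-primitive) =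
        trans (iter≡^* m x) (trans (cong (_* x) sᵐ≡1) (*-identityˡ x)) ,
        λ k 0<k k<m fᵏx≡x → s-primitive k 0<k k<m
          (*-cancelʳ x≢0 (trans (sym (iter≡^* k x)) (trans fᵏx≡x (sym (*-identityˡ x)))))

      cycleType : ∀ {m} → 1 < m → (∀ {x} → x ≢ 0# → HasOrder (s x) m) → CycleType1+m f m
      cycleType 1<m s-order = 0# , trans (f≡s* 0#) (zeroʳ _) , fixed≡0 , λ _ y≢0 → orbit y≢0 (s-order y≢0)
        where
          fixed≡0 : ∀ y → f y ≡ y → y ≡ 0#
          fixed≡0 y fy≡y with y ≟ 0#
          ... | yes y≡0 = y≡0
          ... | no  y≢0 = ⊥-elim (proj₂ (orbit y≢0 (s-order y≢0)) 1 (s≤s z≤n) 1<m fy≡y)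

module Interpolation {q : ℕ} (F : FiniteField q) (ζ t : FiniteField.Carrier F) where
  open FiniteField F
  open FieldProperties F
  open CubeRootsOfUnity F
  open SemiringSolver commutativeSemiring using (solve; _:=_; _:+_; _:*_; con)

  interpolant : Carrier → Carrier → Carrier → Carrier → Carrier
  interpolant U V W ρ = (U + V * ζ + W * (ζ * ζ)) * t * (ρ * ρ) + (U + V * (ζ * ζ) + W * ζ) * t * ρ + (U + V + W) * t

  module _ (ζ³≡1 : ζ ^ 3 ≡ 1#) (ζ≢1 : ζ ≢ 1#) (3t≡1 : (1# + 1# + 1#) * t ≡ 1#) where

    -- Identities of this shape evaluate the interpolant at 1, ζ and ζ²; the summand X keeps them
    -- subtraction-free, as the semiring solver requires.
    evaluate : ∀ {P Z X Y} → P + X ≡ Z * ((1# + 1# + 1#) * t) + Y * (1# + ζ + ζ * ζ) + X * ζ ^ 3 → P ≡ Z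
    evaluate {P} {Z} {X} {Y} eq = +-cancelʳ X P Z (begin
      P + X
        ≡⟨ eq ⟩
      Z * ((1# + 1# + 1#) * t) + Y * (1# + ζ + ζ * ζ) + X * ζ ^ 3
        ≡⟨ cong₂ (λ h r → Z * h + Y * (1# + ζ + ζ * ζ) + X * r) 3t≡1 ζ³≡1 ⟩
      Z * 1# + Y * (1# + ζ + ζ * ζ) + X * 1#
        ≡⟨ cong (λ s → Z * 1# + Y * s + X * 1#) (cubeRoot-sum≡0 ζ³≡1 ζ≢1) ⟩
      Z * 1# + Y * 0# + X * 1#
        ≡⟨ solve 3 (λ Z Y X → Z :* con 1 :+ Y :* con 0 :+ X :* con 1 := Z :+ X) refl Z Y X ⟩
      Z + X ∎)
      where open ≡-Reasoning

    interpolant-1 : ∀ U V W → interpolant U V W 1# ≡ U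
    interpolant-1 U V W = evaluate (solve 5 (λ U V W z t →
      (U :+ V :* z :+ W :* (z :* z)) :* t :* (con 1 :* con 1) :+ (U :+ V :* (z :* z) :+ W :* z) :* t :* con 1
        :+ (U :+ V :+ W) :* t :+ con 0
      := U :* ((con 1 :+ con 1 :+ con 1) :* t) :+ t :* (V :+ W) :* (con 1 :+ z :+ z :* z)
        :+ con 0 :* (z :* (z :* (z :* con 1))))
      refl U V W ζ t)

    interpolant-ζ : ∀ U V W → interpolant U V W ζ ≡ V
    interpolant-ζ U V W = evaluate (solve 5 (λ U V W z t →
      (U :+ V :* z :+ W :* (z :* z)) :* t :* (z :* z) :+ (U :+ V :* (z :* z) :+ W :* z) :* t :* z
        :+ (U :+ V :+ W) :* t :+ t :* (W :* z :+ V :+ V)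
      := V :* ((con 1 :+ con 1 :+ con 1) :* t) :+ t :* (U :+ W) :* (con 1 :+ z :+ z :* z)
        :+ t :* (W :* z :+ V :+ V) :* (z :* (z :* (z :* con 1))))
      refl U V W ζ t)

    interpolant-ζ² : ∀ U V W → interpolant U V W (ζ * ζ) ≡ W
    interpolant-ζ² U V W = evaluate (solve 5 (λ U V W z t → let z³ = z :* (z :* (z :* con 1)) in
      (U :+ V :* z :+ W :* (z :* z)) :* t :* ((z :* z) :* (z :* z)) :+ (U :+ V :* (z :* z) :+ W :* z) :* t :* (z :* z)
        :+ (U :+ V :+ W) :* t :+ t :* (U :* z :+ V :* (z :* z :+ z) :+ W :* (z³ :+ con 1 :+ con 1))
      := W :* ((con 1 :+ con 1 :+ con 1) :* t) :+ t :* (U :+ V) :* (con 1 :+ z :+ z :* z)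
        :+ t :* (U :* z :+ V :* (z :* z :+ z) :+ W :* (z³ :+ con 1 :+ con 1)) :* z³)
      refl U V W ζ t)

    interpolant-elim : ∀ {ρ} → ρ ^ 3 ≡ 1# → (R : Carrier → Carrier → Set) → ∀ {U V W U′ V′ W′} →
                       R U U′ → R V V′ → R W W′ → R (interpolant U V W ρ) (interpolant U′ V′ W′ ρ)
    interpolant-elim ρ³≡1 R rU rV rW with cubeRoot-cases ζ³≡1 ζ≢1 ρ³≡1
    ... | inj₁ refl        = subst₂ R (sym (interpolant-1 _ _ _)) (sym (interpolant-1 _ _ _)) rU
    ... | inj₂ (inj₁ refl) = subst₂ R (sym (interpolant-ζ _ _ _)) (sym (interpolant-ζ _ _ _)) rV
    ... | inj₂ (inj₂ refl) = subst₂ R (sym (interpolant-ζ² _ _ _)) (sym (interpolant-ζ² _ _ _)) rW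

module Trinomial {q : ℕ} (F : FiniteField q) (ζ t : FiniteField.Carrier F) (N : ℕ) where
  open FiniteField F
  open FieldProperties F
  open FermatsLittleTheorem F
  open ScalingMaps F
  open Interpolation F ζ t
  open SemiringSolver commutativeSemiring using (solve; _:=_; _:+_; _:*_)

  trinomial : Carrier → Carrier → Carrier → Carrier → Carrier
  trinomial U V W x =
    (U + V * ζ + W * (ζ * ζ)) * t * x ^ suc (N +ℕ N) + (U + V * (ζ * ζ) + W * ζ) * t * x ^ suc N + (U + V + W) * t * x

  multiplier : Carrier → Carrier → Carrier → Carrier → Carrier
  multiplier U V W x = interpolant U V W (x ^ N)

  trinomial≡multiplier* : ∀ U V W x → trinomial U V W x ≡ multiplier U V W x * x
  trinomial≡multiplier* U V W x = begin
    A * (x * x ^ (N +ℕ N)) + B * (x * ρ) + C * x     ≡⟨ cong (λ y → A * (x * y) + B * (x * ρ) + C * x) (^-homo-* x N N) ⟩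
    A * (x * (ρ * ρ)) + B * (x * ρ) + C * x          ≡⟨ solve 5 (λ A B C ρ x → A :* (x :* (ρ :* ρ)) :+ B :* (x :* ρ) :+ C :* x
                                                                  := (A :* (ρ :* ρ) :+ B :* ρ :+ C) :* x) refl A B C ρ x ⟩
    (A * (ρ * ρ) + B * ρ + C) * x                    ∎
    where
      open ≡-Reasoning
      ρ = x ^ N
      A = (U + V * ζ + W * (ζ * ζ)) * t
      B = (U + V * (ζ * ζ) + W * ζ) * t
      C = (U + V + W) * t

  module OrderedCoefficients (ζ³≡1 : ζ ^ 3 ≡ 1#) (ζ≢1 : ζ ≢ 1#) (3t≡1 : (1# + 1# + 1#) * t ≡ 1#)
    (q∸1≡N*3 : q ∸ 1 ≡ N *ℕ 3) {m : ℕ} (m∣N : m ∣ N) {u v w u⁻ v⁻ w⁻ : Carrier}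
    (ou : HasOrder u m) (ov : HasOrder v m) (ow : HasOrder w m)
    (uu⁻ : u * u⁻ ≡ 1#) (vv⁻ : v * v⁻ ≡ 1#) (ww⁻ : w * w⁻ ≡ 1#) where

    ^N-cubeRoot : ∀ {x} → x ≢ 0# → (x ^ N) ^ 3 ≡ 1#
    ^N-cubeRoot {x} x≢0 = trans (^-assocʳ x N 3) (trans (cong (x ^_) (sym q∸1≡N*3)) (fermat x≢0))

    private
      f g s s′ : Carrier → Carrier
      f = trinomial u v w
      g = trinomial u⁻ v⁻ w⁻
      s = multiplier u v w
      s′ = multiplier u⁻ v⁻ w⁻

      coefficientPair : ∀ {x} → x ≢ 0# → HasOrder (s x) m × s x * s′ x ≡ 1#
      coefficientPair x≢0 = interpolant-elim ζ³≡1 ζ≢1 3t≡1 (^N-cubeRoot x≢0) (λ S S′ → HasOrder S m × S * S′ ≡ 1#)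
        (ou , uu⁻) (ov , vv⁻) (ow , ww⁻)

      s-order : ∀ {x} → x ≢ 0# → HasOrder (s x) m
      s-order = proj₁ ∘ coefficientPair

      s*s′≡1 : ∀ {x} → x ≢ 0# → s x * s′ x ≡ 1#
      s*s′≡1 = proj₂ ∘ coefficientPair

      s′^N≡1 : ∀ {x} → x ≢ 0# → s′ x ^ N ≡ 1#
      s′^N≡1 x≢0 = ^-inverse {n = N} (s*s′≡1 x≢0) (^-order (s-order x≢0) m∣N)

      f≡s* : ∀ x → f x ≡ s x * x
      f≡s* = trinomial≡multiplier* u v w

      g≡s′* : ∀ x → g x ≡ s′ x * x
      g≡s′* = trinomial≡multiplier* u⁻ v⁻ w⁻

      f-preserves-^N : ∀ x → f x ^ N ≡ x ^ N
      f-preserves-^N = scaling-preserves-^ f≡s* {N} (λ x≢0 → ^-order (s-order x≢0) m∣N)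

      g-preserves-^N : ∀ x → g x ^ N ≡ x ^ N
      g-preserves-^N = scaling-preserves-^ g≡s′* {N} s′^N≡1

    trinomial-cycleType : 1 < m → CycleType1+m f m
    trinomial-cycleType 1<m = cycleType f≡s* (cong (interpolant u v w) ∘ f-preserves-^N) 1<m s-order

    trinomial-leftInverse : ∀ x → g (f x) ≡ x
    trinomial-leftInverse = leftInverse f≡s* g≡s′* (cong (interpolant u⁻ v⁻ w⁻) ∘ f-preserves-^N)
      (λ x≢0 → trans (*-comm _ _) (s*s′≡1 x≢0))

    trinomial-rightInverse : ∀ x → f (g x) ≡ x
    trinomial-rightInverse = leftInverse g≡s′* f≡s* (cong (interpolant u v w) ∘ g-preserves-^N) s*s′≡1

m%3≡1⇒m≡1+[m/3]*3 : ∀ m → m % 3 ≡ 1 → m ≡ suc (m / 3 *ℕ 3)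
m%3≡1⇒m≡1+[m/3]*3 m m%3≡1 = trans (m≡m%n+[m/n]*n m 3) (cong (_+ℕ m / 3 *ℕ 3) m%3≡1)

exponent₁ : ∀ q → q % 3 ≡ 1 → (2 *ℕ q +ℕ 1) / 3 ≡ suc (q / 3 +ℕ q / 3)
exponent₁ q q%3≡1 = begin
  (2 *ℕ q +ℕ 1) / 3                      ≡⟨ cong (λ n → (2 *ℕ n +ℕ 1) / 3) (m%3≡1⇒m≡1+[m/3]*3 q q%3≡1) ⟩
  (2 *ℕ suc (N *ℕ 3) +ℕ 1) / 3           ≡⟨ cong (_/ 3) (lemma N) ⟩
  suc (N +ℕ N) *ℕ 3 / 3                  ≡⟨ m*n/n≡m (suc (N +ℕ N)) 3 ⟩
  suc (N +ℕ N)                           ∎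
  where
    open ≡-Reasoning
    N = q / 3
    lemma : ∀ N → 2 *ℕ suc (N *ℕ 3) +ℕ 1 ≡ suc (N +ℕ N) *ℕ 3
    lemma = solve-∀

exponent₂ : ∀ q → q % 3 ≡ 1 → (q +ℕ 2) / 3 ≡ suc (q / 3)
exponent₂ q q%3≡1 = begin
  (q +ℕ 2) / 3                   ≡⟨ cong (λ n → (n +ℕ 2) / 3) (m%3≡1⇒m≡1+[m/3]*3 q q%3≡1) ⟩
  (suc (N *ℕ 3) +ℕ 2) / 3        ≡⟨ cong (_/ 3) (lemma N) ⟩
  suc N *ℕ 3 / 3                 ≡⟨ m*n/n≡m (suc N) 3 ⟩
  suc N                          ∎
  where
    open ≡-Reasoning
    N = q / 3
    lemma : ∀ N → suc (N *ℕ 3) +ℕ 2 ≡ suc N *ℕ 3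
    lemma = solve-∀

∣-cancelʳ-* : ∀ {N m d n} .{{_ : NonZero n}} → N *ℕ n ≡ m *ℕ d → n ∣ d → m ∣ N
∣-cancelʳ-* {N} {m} {n = n} N*n≡m*d (divides k refl) =
  divides k (ℕ.*-cancelʳ-≡ N (k *ℕ m) n (trans N*n≡m*d (trans (sym (ℕ.*-assoc m k n)) (cong (_*ℕ n) (ℕ.*-comm m k)))))

mainTheorem3 : (q : ℕ) →
    (∃₂ λ p k → Prime p × p % 2 ≡ 1 × q ≡ p ^ℕ suc k) →
    q % 3 ≡ 1 →
    (F : FiniteField q) →
    let open FiniteField F in
    (ζ : Carrier) → HasOrder ζ 3 →
    (t : Carrier) → (1# + 1# + 1#) * t ≡ 1# →
    (m d : ℕ) → 1 ≤ m → 1 ≤ d → q ∸ 1 ≡ m *ℕ d → d % 3 ≡ 0 → 3 ≤ φ m →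
    (u v w : Carrier) → HasOrder u m → HasOrder v m → HasOrder w m →
    ¬ (u ≡ v × v ≡ w) →
    (u⁻ v⁻ w⁻ : Carrier) → u * u⁻ ≡ 1# → v * v⁻ ≡ 1# → w * w⁻ ≡ 1# →
    let a  = (u + v * ζ + w * (ζ * ζ)) * t
        b  = (u + v * (ζ * ζ) + w * ζ) * t
        c  = (u + v + w) * t
        a′ = (u⁻ + v⁻ * ζ + w⁻ * (ζ * ζ)) * t
        b′ = (u⁻ + v⁻ * (ζ * ζ) + w⁻ * ζ) * t
        c′ = (u⁻ + v⁻ + w⁻) * t
        e₁ = (2 *ℕ q +ℕ 1) / 3
        e₂ = (q +ℕ 2) / 3
        f  = λ x → a * x ^ e₁ + b * x ^ e₂ + c * x
        g  = λ x → a′ * x ^ e₁ + b′ * x ^ e₂ + c′ * x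
    in
    -- (i) f is a permutation of F_q
    (∃ λ (π : Carrier ↔ Carrier) → ∀ x → Inverse.to π x ≡ f x) ×
    -- (ii) cycle type 1 + m^d
    CycleType1+m f m ×
    -- (iii) g induces the inverse permutation
    ((∀ x → g (f x) ≡ x) × (∀ x → f (g x) ≡ x))
mainTheorem3 q _ q%3≡1 F ζ ζ-order t 3t≡1 m d _ _ q∸1≡m*d d%3≡0 3≤φm u v w ou ov ow _ u⁻ v⁻ w⁻ uu⁻ vv⁻ ww⁻
  rewrite exponent₁ q q%3≡1 | exponent₂ q q%3≡1 =
    (mk↔ₛ′ _ _ trinomial-rightInverse trinomial-leftInverse , λ _ → refl) ,
    trinomial-cycleType 1<m ,
    trinomial-leftInverse , trinomial-rightInverse
  where
    open FieldProperties F
    N = q / 3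
    q∸1≡N*3 : q ∸ 1 ≡ N *ℕ 3
    q∸1≡N*3 = cong (_∸ 1) (m%3≡1⇒m≡1+[m/3]*3 q q%3≡1)
    m∣N : m ∣ N
    m∣N = ∣-cancelʳ-* (trans (sym q∸1≡N*3) q∸1≡m*d) (m%n≡0⇒n∣m d 3 d%3≡0)
    1<m : 1 < m
    1<m = ℕ.≤-trans (ℕ.n≤1+n 2) (ℕ.≤-trans 3≤φm (φ≤id m))
    open Trinomial.OrderedCoefficients F ζ t N (proj₁ (proj₂ ζ-order)) (hasOrder⇒≢1 ζ-order (s≤s (s≤s z≤n))) 3t≡1
      q∸1≡N*3 m∣N ou ov ow uu⁻ vv⁻ ww⁻
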